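{- Let $\alpha$ and $\beta$ be permutations of sizes $n$ and $m$ respectively, let $k\ge1$, and suppose that $\alpha\sim_k\beta$. Then for every permutation $\sigma$, $\alpha[\sigma,\sigma,\dots,\sigma]\sim_k\beta[\sigma,\sigma,\dots,\sigma]$.
   Context: A permutation $\sigma$ of size $n$ is identified with the finite structure with domain $A^\sigma=\{(i,\sigma(i)) : 1\le i\le n\}$, position order $<_P$ (first coordinates) and value order $<_V$ (second coordinates); $\mathsf{TOTO}$ is first-order logic (with equality) over the signature $\{<_P,<_V\}$. For permutations $\alpha,\beta$, $\alpha\sim_k\beta$ means that $\alpha$ and $\beta$ satisfy the same $\mathsf{TOTO}$ sentences of quantifier depth at most $k$ (equivalently, Duplicator wins the $k$-move Ehrenfeucht–Fraïssé game on $\alpha,\beta$). Given $\pi$ of size $n$ and permutations $\sigma_1,\dots,\sigma_n$, the inflation $\pi[\sigma_1,\dots,\sigma_n]$ is the permutation whose diagram is obtained from that of $\pi$ by replacing each point $(i,\pi(i))$ by the diagram of $\sigma_i$; $\alpha[\sigma,\dots,\sigma]$ denotes inflation of every point of $\alpha$ by the same $\sigma$. -}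

module Defs where

open import Data.Nat using (ℕ; zero; suc; _+_; _*_; _⊔_)
open import Data.Fin using (Fin; combine; remQuot)
  renaming (_<_ to _<ᶠ_)
open import Data.Fin.Properties using (remQuot-combine; combine-remQuot)
open import Data.Fin.Permutation using (Permutation′; permutation; _⟨$⟩ʳ_; _⟨$⟩ˡ_; inverseˡ; inverseʳ)
open import Data.Vec.Functional using (_∷_)
open import Data.Product using (Σ; _×_; _,_; proj₁; proj₂)
open import Data.Sum using (_⊎_)
open import Relation.Nullary using (¬_)
open import Relation.Binary.PropositionalEquality using (_≡_; refl; cong; trans; sym; cong₂)
open import Function.Bundles using (_⇔_)

data Formula : ℕ → Set where
  _≐_   : ∀ {v} → Fin v → Fin v → Formula v
  _<P_  : ∀ {v} → Fin v → Fin v → Formula v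
  _<V_  : ∀ {v} → Fin v → Fin v → Formula v
  ¬'_   : ∀ {v} → Formula v → Formula v
  _∧'_  : ∀ {v} → Formula v → Formula v → Formula v
  _∨'_  : ∀ {v} → Formula v → Formula v → Formula v
  _⇒'_  : ∀ {v} → Formula v → Formula v → Formula v
  ∃'    : ∀ {v} → Formula (suc v) → Formula v
  ∀'    : ∀ {v} → Formula (suc v) → Formula v

Sentence : Set
Sentence = Formula 0

qdepth : ∀ {v} → Formula v → ℕ
qdepth (x ≐ y)  = 0
qdepth (x <P y) = 0
qdepth (x <V y) = 0
qdepth (¬' φ)   = qdepth φ
qdepth (φ ∧' ψ) = qdepth φ ⊔ qdepth ψ
qdepth (φ ∨' ψ) = qdepth φ ⊔ qdepth ψ
qdepth (φ ⇒' ψ) = qdepth φ ⊔ qdepth ψ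
qdepth (∃' φ)   = suc (qdepth φ)
qdepth (∀' φ)   = suc (qdepth φ)

-- A permutation σ of size n as a TOTO structure: domain indexed by
-- Fin n (element i is the point (i, σ(i))), <_P compares positions i,
-- <_V compares values σ(i).

⟦_⟧_⊨_ : ∀ {n v} → Permutation′ n → (Fin v → Fin n) → Formula v → Set
⟦ σ ⟧ e ⊨ (x ≐ y)  = e x ≡ e y
⟦ σ ⟧ e ⊨ (x <P y) = e x <ᶠ e y
⟦ σ ⟧ e ⊨ (x <V y) = (σ ⟨$⟩ʳ e x) <ᶠ (σ ⟨$⟩ʳ e y)
⟦ σ ⟧ e ⊨ (¬' φ)   = ¬ (⟦ σ ⟧ e ⊨ φ)
⟦ σ ⟧ e ⊨ (φ ∧' ψ) = (⟦ σ ⟧ e ⊨ φ) × (⟦ σ ⟧ e ⊨ ψ)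
⟦ σ ⟧ e ⊨ (φ ∨' ψ) = (⟦ σ ⟧ e ⊨ φ) ⊎ (⟦ σ ⟧ e ⊨ ψ)
⟦ σ ⟧ e ⊨ (φ ⇒' ψ) = (⟦ σ ⟧ e ⊨ φ) → (⟦ σ ⟧ e ⊨ ψ)
⟦ σ ⟧ e ⊨ (∃' φ)   = Σ (Fin _) λ a → ⟦ σ ⟧ (a ∷ e) ⊨ φ
⟦ σ ⟧ e ⊨ (∀' φ)   = (a : Fin _) → ⟦ σ ⟧ (a ∷ e) ⊨ φ

_⊨_ : ∀ {n} → Permutation′ n → Sentence → Set
σ ⊨ φ = ⟦ σ ⟧ (λ ()) ⊨ φ

_∼[_]_ : ∀ {n m} → Permutation′ n → ℕ → Permutation′ m → Set
α ∼[ k ] β = (φ : Sentence) → qdepth φ Data.Nat.≤ k → (α ⊨ φ) ⇔ (β ⊨ φ)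

-- The point with block index
-- i (a point of α) and inner index j (a point of σ) sits at position
-- i*m + j and has value α(i)*m + σ(j); `combine i j` is exactly i*m + j.

inflate : ∀ {n m} → Permutation′ n → Permutation′ m → Permutation′ (n * m)
inflate {n} {m} α σ = permutation f g fg gf
  where
  f : Fin (n * m) → Fin (n * m)
  f x = let (i , j) = remQuot {n} m x in combine (α ⟨$⟩ʳ i) (σ ⟨$⟩ʳ j)
  g : Fin (n * m) → Fin (n * m)
  g x = let (i , j) = remQuot {n} m x in combine (α ⟨$⟩ˡ i) (σ ⟨$⟩ˡ j)
  fg : ∀ y → f (g y) ≡ y
  fg y = trans (cong (λ p → combine (α ⟨$⟩ʳ proj₁ p) (σ ⟨$⟩ʳ proj₂ p))
                     (remQuot-combine {n} {m} (α ⟨$⟩ˡ proj₁ (remQuot {n} m y)) (σ ⟨$⟩ˡ proj₂ (remQuot {n} m y))))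
               (trans (cong₂ combine (inverseʳ α) (inverseʳ σ)) (combine-remQuot {n} m y))
  gf : ∀ y → g (f y) ≡ y
  gf y = trans (cong (λ p → combine (α ⟨$⟩ˡ proj₁ p) (σ ⟨$⟩ˡ proj₂ p))
                     (remQuot-combine {n} {m} (α ⟨$⟩ʳ proj₁ (remQuot {n} m y)) (σ ⟨$⟩ʳ proj₂ (remQuot {n} m y))))
               (trans (cong₂ combine (inverseˡ α) (inverseˡ σ)) (combine-remQuot {n} m y))

module Submission where

-- A point of α[σ,…,σ] is a pair (i, j) of a point i of α and a point j of σ, and both
-- orders compare such pairs lexicographically (on values through α and σ).  So once the
-- σ-components ρ of the variables are fixed, a formula over α[σ,…,σ] translates into a
-- formula over α of no greater quantifier depth: an atom becomes the corresponding atom of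
-- α, possibly disjoined with (or conjoined to) an equality according to how ρ compares
-- the σ-components, and a quantifier over α[σ,…,σ] becomes a quantifier over α followed by
-- a finite disjunction (conjunction) over the points of σ.  Hence a sentence of depth ≤ k
-- holds in α[σ,…,σ] iff its translation holds in α, and the same for β.

open import Defs
open import Data.Nat using (ℕ; zero; suc; _≤_; _<_; _*_; _⊔_; z≤n; s≤s)
open import Data.Nat.Properties using (≤-refl; ≤-reflexive; ≤-trans; ⊔-idem; m≤m⊔n; ⊔-lub; ⊔-mono-≤; +-monoʳ-<; +-cancelˡ-<)
open import Data.Fin using (Fin; combine; remQuot; toℕ) renaming (_<_ to _<ᶠ_; zero to fzero; suc to fsuc)
open import Data.Fin.Properties using (combine-remQuot; remQuot-combine; toℕ-combine; combine-monoˡ-<; combine-injective; <-cmp; <-asym; _≟_; _<?_)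
open import Data.Fin.Permutation using (Permutation′; _⟨$⟩ʳ_)
open import Data.Vec.Functional using (_∷_)
open import Data.Product using (Σ; _×_; _,_; proj₁; uncurry)
open import Data.Product.Function.NonDependent.Propositional using (_×-cong_)
open import Data.Product.Function.Dependent.Propositional using (congˡ)
open import Data.Sum using (_⊎_; inj₁; inj₂; map₂)
open import Data.Sum.Function.Propositional using (_⊎-cong_)
open import Relation.Nullary using (Dec; yes; no; contradiction)
open import Relation.Binary.Definitions using (tri<; tri≈; tri>)
open import Relation.Binary.PropositionalEquality using (_≡_; _≗_; refl; sym; trans; cong; cong₂; subst; subst₂)
open import Function.Bundles using (_⇔_; mk⇔; Equivalence; Injection)
open import Function.Properties.Inverse using (↔⇒↣)
open import Function.Related.Propositional using (K-refl; SK-sym; module EquationalReasoning)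
open import Function.Related.TypeIsomorphisms using (¬-cong-⇔; →-cong-⇔)

private
  variable
    v n s : ℕ

combine-<-⇔ : ∀ (i k : Fin n) (j l : Fin s) →
  (combine i j <ᶠ combine k l) ⇔ ((i <ᶠ k) ⊎ (i ≡ k × j <ᶠ l))
combine-<-⇔ {s = s} i k j l = mk⇔ to from
  where
  to : combine i j <ᶠ combine k l → (i <ᶠ k) ⊎ (i ≡ k × j <ᶠ l)
  to ij<kl with <-cmp i k
  ... | tri< i<k _ _ = inj₁ i<k
  ... | tri≈ _ refl _ = inj₂ (refl , +-cancelˡ-< (s * toℕ i) (toℕ j) (toℕ l)
                                       (subst₂ _<_ (toℕ-combine i j) (toℕ-combine i l) ij<kl))
  ... | tri> _ _ k<i = contradiction (combine-monoˡ-< l j k<i) (<-asym ij<kl)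
  from : (i <ᶠ k) ⊎ (i ≡ k × j <ᶠ l) → combine i j <ᶠ combine k l
  from (inj₁ i<k)         = combine-monoˡ-< j l i<k
  from (inj₂ (refl , j<l)) = subst₂ _<_ (sym (toℕ-combine i j)) (sym (toℕ-combine i l))
                                    (+-monoʳ-< (s * toℕ i) j<l)

combine-≡-⇔ : ∀ (i k : Fin n) (j l : Fin s) → (combine i j ≡ combine k l) ⇔ (i ≡ k × j ≡ l)
combine-≡-⇔ i k j l = mk⇔ (combine-injective i j k l) (uncurry (cong₂ combine))

Σ-combine-⇔ : ∀ {P : Fin (n * s) → Set} →
  Σ (Fin (n * s)) P ⇔ Σ (Fin n) λ i → Σ (Fin s) λ j → P (combine i j)
Σ-combine-⇔ {n} {s} {P} = mk⇔ to from
  where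
  to : Σ (Fin (n * s)) P → Σ (Fin n) λ i → Σ (Fin s) λ j → P (combine i j)
  to (a , p) = let (i , j) = remQuot {n} s a in i , j , subst P (sym (combine-remQuot {n} s a)) p
  from : (Σ (Fin n) λ i → Σ (Fin s) λ j → P (combine i j)) → Σ (Fin (n * s)) P
  from (i , j , p) = combine i j , p

Π-combine-⇔ : ∀ {P : Fin (n * s) → Set} →
  ((a : Fin (n * s)) → P a) ⇔ ((i : Fin n) (j : Fin s) → P (combine i j))
Π-combine-⇔ {n} {s} {P} = mk⇔ (λ p i j → p (combine i j))
  (λ p a → subst P (combine-remQuot {n} s a) (uncurry p (remQuot {n} s a)))

Π-cong-⇔ : ∀ {A : Set} {P Q : A → Set} → (∀ a → P a ⇔ Q a) → ((a : A) → P a) ⇔ ((a : A) → Q a)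
Π-cong-⇔ P⇔Q = mk⇔ (λ p a → Equivalence.to (P⇔Q a) (p a)) (λ q a → Equivalence.from (P⇔Q a) (q a))

orIf : ∀ {C : Set} → Dec C → Formula v → Formula v → Formula v
orIf (yes _) φ ψ = φ ∨' ψ
orIf (no _)  φ ψ = φ

andIf : ∀ {C : Set} → Dec C → Formula v → Formula v
andIf (yes _) φ = φ
andIf (no _)  φ = φ ∧' (¬' φ)

⋁ : (Fin s → Formula (suc v)) → Formula (suc v)
⋁ {zero}  φ = ¬' (fzero ≐ fzero)
⋁ {suc s} φ = φ fzero ∨' ⋁ (λ j → φ (fsuc j))

⋀ : (Fin s → Formula (suc v)) → Formula (suc v)
⋀ {zero}  φ = fzero ≐ fzero
⋀ {suc s} φ = φ fzero ∧' ⋀ (λ j → φ (fsuc j))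

module _ {m : ℕ} (π : Permutation′ m) where

  orIf-⊨ : ∀ {C : Set} (d : Dec C) (e : Fin v → Fin m) (φ ψ : Formula v) →
    (⟦ π ⟧ e ⊨ orIf d φ ψ) ⇔ ((⟦ π ⟧ e ⊨ φ) ⊎ ((⟦ π ⟧ e ⊨ ψ) × C))
  orIf-⊨ (yes c) e φ ψ = mk⇔ (map₂ (_, c)) (map₂ proj₁)
  orIf-⊨ (no ¬c) e φ ψ = mk⇔ inj₁ λ { (inj₁ p) → p ; (inj₂ (_ , c)) → contradiction c ¬c }

  andIf-⊨ : ∀ {C : Set} (d : Dec C) (e : Fin v → Fin m) (φ : Formula v) →
    (⟦ π ⟧ e ⊨ andIf d φ) ⇔ ((⟦ π ⟧ e ⊨ φ) × C)
  andIf-⊨ (yes c) e φ = mk⇔ (_, c) proj₁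
  andIf-⊨ (no ¬c) e φ = mk⇔ (λ (p , ¬p) → contradiction p ¬p) (λ (_ , c) → contradiction c ¬c)

  ⋁-⊨ : ∀ (e : Fin (suc v) → Fin m) (φ : Fin s → Formula (suc v)) →
    (⟦ π ⟧ e ⊨ ⋁ φ) ⇔ Σ (Fin s) λ j → ⟦ π ⟧ e ⊨ φ j
  ⋁-⊨ {s = zero}  e φ = mk⇔ (λ ¬refl → contradiction refl ¬refl) λ ()
  ⋁-⊨ {s = suc s} e φ = mk⇔ to from
    where
    to : ⟦ π ⟧ e ⊨ ⋁ φ → Σ (Fin (suc s)) λ j → ⟦ π ⟧ e ⊨ φ j
    to (inj₁ p) = fzero , p
    to (inj₂ p) = let (j , q) = Equivalence.to (⋁-⊨ e _) p in fsuc j , q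
    from : (Σ (Fin (suc s)) λ j → ⟦ π ⟧ e ⊨ φ j) → ⟦ π ⟧ e ⊨ ⋁ φ
    from (fzero , p)  = inj₁ p
    from (fsuc j , p) = inj₂ (Equivalence.from (⋁-⊨ e _) (j , p))

  ⋀-⊨ : ∀ (e : Fin (suc v) → Fin m) (φ : Fin s → Formula (suc v)) →
    (⟦ π ⟧ e ⊨ ⋀ φ) ⇔ ((j : Fin s) → ⟦ π ⟧ e ⊨ φ j)
  ⋀-⊨ {s = zero}  e φ = mk⇔ (λ _ ()) (λ _ → refl)
  ⋀-⊨ {s = suc s} e φ = mk⇔ to from
    where
    to : ⟦ π ⟧ e ⊨ ⋀ φ → (j : Fin (suc s)) → ⟦ π ⟧ e ⊨ φ j
    to (p , q) fzero    = p
    to (p , q) (fsuc j) = Equivalence.to (⋀-⊨ e _) q j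
    from : ((j : Fin (suc s)) → ⟦ π ⟧ e ⊨ φ j) → ⟦ π ⟧ e ⊨ ⋀ φ
    from p = p fzero , Equivalence.from (⋀-⊨ e _) (λ j → p (fsuc j))

orIf-qdepth : ∀ {C : Set} (d : Dec C) (φ ψ : Formula v) → qdepth (orIf d φ ψ) ≤ qdepth φ ⊔ qdepth ψ
orIf-qdepth (yes _) φ ψ = ≤-refl
orIf-qdepth (no _)  φ ψ = m≤m⊔n (qdepth φ) (qdepth ψ)

andIf-qdepth : ∀ {C : Set} (d : Dec C) (φ : Formula v) → qdepth (andIf d φ) ≤ qdepth φ
andIf-qdepth (yes _) φ = ≤-refl
andIf-qdepth (no _)  φ = ≤-reflexive (⊔-idem (qdepth φ))

⋁-qdepth : ∀ {d} (φ : Fin s → Formula (suc v)) → (∀ j → qdepth (φ j) ≤ d) → qdepth (⋁ φ) ≤ d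
⋁-qdepth {zero}  φ φ≤d = z≤n
⋁-qdepth {suc s} φ φ≤d = ⊔-lub (φ≤d fzero) (⋁-qdepth _ (λ j → φ≤d (fsuc j)))

⋀-qdepth : ∀ {d} (φ : Fin s → Formula (suc v)) → (∀ j → qdepth (φ j) ≤ d) → qdepth (⋀ φ) ≤ d
⋀-qdepth {zero}  φ φ≤d = z≤n
⋀-qdepth {suc s} φ φ≤d = ⊔-lub (φ≤d fzero) (⋀-qdepth _ (λ j → φ≤d (fsuc j)))

translate : Permutation′ s → (Fin v → Fin s) → Formula v → Formula v
translate σ ρ (x ≐ y)  = andIf (ρ x ≟ ρ y) (x ≐ y)
translate σ ρ (x <P y) = orIf (ρ x <? ρ y) (x <P y) (x ≐ y)
translate σ ρ (x <V y) = orIf (σ ⟨$⟩ʳ ρ x <? σ ⟨$⟩ʳ ρ y) (x <V y) (x ≐ y)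
translate σ ρ (¬' φ)   = ¬' translate σ ρ φ
translate σ ρ (φ ∧' ψ) = translate σ ρ φ ∧' translate σ ρ ψ
translate σ ρ (φ ∨' ψ) = translate σ ρ φ ∨' translate σ ρ ψ
translate σ ρ (φ ⇒' ψ) = translate σ ρ φ ⇒' translate σ ρ ψ
translate σ ρ (∃' φ)   = ∃' (⋁ λ j → translate σ (j ∷ ρ) φ)
translate σ ρ (∀' φ)   = ∀' (⋀ λ j → translate σ (j ∷ ρ) φ)

translate-qdepth : ∀ (σ : Permutation′ s) (ρ : Fin v → Fin s) φ → qdepth (translate σ ρ φ) ≤ qdepth φ
translate-qdepth σ ρ (x ≐ y)  = andIf-qdepth (ρ x ≟ ρ y) (x ≐ y)
translate-qdepth σ ρ (x <P y) = orIf-qdepth (ρ x <? ρ y) (x <P y) (x ≐ y)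
translate-qdepth σ ρ (x <V y) = orIf-qdepth (σ ⟨$⟩ʳ ρ x <? σ ⟨$⟩ʳ ρ y) (x <V y) (x ≐ y)
translate-qdepth σ ρ (¬' φ)   = translate-qdepth σ ρ φ
translate-qdepth σ ρ (φ ∧' ψ) = ⊔-mono-≤ (translate-qdepth σ ρ φ) (translate-qdepth σ ρ ψ)
translate-qdepth σ ρ (φ ∨' ψ) = ⊔-mono-≤ (translate-qdepth σ ρ φ) (translate-qdepth σ ρ ψ)
translate-qdepth σ ρ (φ ⇒' ψ) = ⊔-mono-≤ (translate-qdepth σ ρ φ) (translate-qdepth σ ρ ψ)
translate-qdepth σ ρ (∃' φ)   = s≤s (⋁-qdepth _ λ j → translate-qdepth σ (j ∷ ρ) φ)
translate-qdepth σ ρ (∀' φ)   = s≤s (⋀-qdepth _ λ j → translate-qdepth σ (j ∷ ρ) φ)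

_⊗_ : (Fin v → Fin n) → (Fin v → Fin s) → Fin v → Fin (n * s)
(b ⊗ ρ) x = combine (b x) (ρ x)

∷-⊗ : ∀ {e : Fin v → Fin (n * s)} {b ρ} (i : Fin n) (j : Fin s) →
  e ≗ b ⊗ ρ → (combine i j ∷ e) ≗ (i ∷ b) ⊗ (j ∷ ρ)
∷-⊗ i j e≗b⊗ρ fzero    = refl
∷-⊗ i j e≗b⊗ρ (fsuc x) = e≗b⊗ρ x

inflate-⟨$⟩ʳ : ∀ (α : Permutation′ n) (σ : Permutation′ s) i j →
  inflate α σ ⟨$⟩ʳ combine i j ≡ combine (α ⟨$⟩ʳ i) (σ ⟨$⟩ʳ j)
inflate-⟨$⟩ʳ {n} {s} α σ i j =
  cong (λ (i′ , j′) → combine (α ⟨$⟩ʳ i′) (σ ⟨$⟩ʳ j′)) (remQuot-combine {n} {s} i j)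

⟨$⟩ʳ-≡-⇔ : ∀ (α : Permutation′ n) {i k} → (α ⟨$⟩ʳ i ≡ α ⟨$⟩ʳ k) ⇔ (i ≡ k)
⟨$⟩ʳ-≡-⇔ α = mk⇔ (Injection.injective (↔⇒↣ α)) (cong (α ⟨$⟩ʳ_))

module _ (α : Permutation′ n) (σ : Permutation′ s) where
  open EquationalReasoning

  inflate-⊨-⇔ : ∀ (φ : Formula v) {e b ρ} → e ≗ b ⊗ ρ →
    (⟦ inflate α σ ⟧ e ⊨ φ) ⇔ (⟦ α ⟧ b ⊨ translate σ ρ φ)
  inflate-⊨-⇔ (x ≐ y) {e} {b} {ρ} e≗b⊗ρ = begin
    e x ≡ e y                                 ≡⟨ cong₂ _≡_ (e≗b⊗ρ x) (e≗b⊗ρ y) ⟩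
    combine (b x) (ρ x) ≡ combine (b y) (ρ y) ∼⟨ combine-≡-⇔ (b x) (b y) (ρ x) (ρ y) ⟩
    (b x ≡ b y × ρ x ≡ ρ y)                   ∼⟨ SK-sym (andIf-⊨ α (ρ x ≟ ρ y) b (x ≐ y)) ⟩
    ⟦ α ⟧ b ⊨ translate σ ρ (x ≐ y)           ∎
  inflate-⊨-⇔ (x <P y) {e} {b} {ρ} e≗b⊗ρ = begin
    e x <ᶠ e y                                          ≡⟨ cong₂ _<ᶠ_ (e≗b⊗ρ x) (e≗b⊗ρ y) ⟩
    combine (b x) (ρ x) <ᶠ combine (b y) (ρ y)          ∼⟨ combine-<-⇔ (b x) (b y) (ρ x) (ρ y) ⟩
    ((b x <ᶠ b y) ⊎ (b x ≡ b y × ρ x <ᶠ ρ y))           ∼⟨ SK-sym (orIf-⊨ α (ρ x <? ρ y) b (x <P y) (x ≐ y)) ⟩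
    ⟦ α ⟧ b ⊨ translate σ ρ (x <P y)                    ∎
  inflate-⊨-⇔ {v} (x <V y) {e} {b} {ρ} e≗b⊗ρ = begin
    inflate α σ ⟨$⟩ʳ e x <ᶠ inflate α σ ⟨$⟩ʳ e y        ≡⟨ cong₂ _<ᶠ_ (value x) (value y) ⟩
    combine (α′ x) (σ′ x) <ᶠ combine (α′ y) (σ′ y)      ∼⟨ combine-<-⇔ (α′ x) (α′ y) (σ′ x) (σ′ y) ⟩
    ((α′ x <ᶠ α′ y) ⊎ (α′ x ≡ α′ y × σ′ x <ᶠ σ′ y))     ∼⟨ K-refl ⊎-cong (⟨$⟩ʳ-≡-⇔ α ×-cong K-refl) ⟩
    ((α′ x <ᶠ α′ y) ⊎ (b x ≡ b y × σ′ x <ᶠ σ′ y))       ∼⟨ SK-sym (orIf-⊨ α (σ′ x <? σ′ y) b (x <V y) (x ≐ y)) ⟩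
    ⟦ α ⟧ b ⊨ translate σ ρ (x <V y)                    ∎
    where
    α′ : Fin v → Fin n
    α′ z = α ⟨$⟩ʳ b z
    σ′ : Fin v → Fin s
    σ′ z = σ ⟨$⟩ʳ ρ z
    value : ∀ z → inflate α σ ⟨$⟩ʳ e z ≡ combine (α′ z) (σ′ z)
    value z = trans (cong (inflate α σ ⟨$⟩ʳ_) (e≗b⊗ρ z)) (inflate-⟨$⟩ʳ α σ (b z) (ρ z))
  inflate-⊨-⇔ (¬' φ)   e≗b⊗ρ = ¬-cong-⇔ (inflate-⊨-⇔ φ e≗b⊗ρ)
  inflate-⊨-⇔ (φ ∧' ψ) e≗b⊗ρ = inflate-⊨-⇔ φ e≗b⊗ρ ×-cong inflate-⊨-⇔ ψ e≗b⊗ρ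
  inflate-⊨-⇔ (φ ∨' ψ) e≗b⊗ρ = inflate-⊨-⇔ φ e≗b⊗ρ ⊎-cong inflate-⊨-⇔ ψ e≗b⊗ρ
  inflate-⊨-⇔ (φ ⇒' ψ) e≗b⊗ρ = →-cong-⇔ (inflate-⊨-⇔ φ e≗b⊗ρ) (inflate-⊨-⇔ ψ e≗b⊗ρ)
  inflate-⊨-⇔ (∃' φ) {e} {b} {ρ} e≗b⊗ρ = begin
    (Σ (Fin (n * s)) λ a → ⟦ inflate α σ ⟧ (a ∷ e) ⊨ φ)
      ∼⟨ Σ-combine-⇔ ⟩
    (Σ (Fin n) λ i → Σ (Fin s) λ j → ⟦ inflate α σ ⟧ (combine i j ∷ e) ⊨ φ)
      ∼⟨ congˡ (λ {i} → congˡ (λ {j} → inflate-⊨-⇔ φ (∷-⊗ i j e≗b⊗ρ))) ⟩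
    (Σ (Fin n) λ i → Σ (Fin s) λ j → ⟦ α ⟧ (i ∷ b) ⊨ translate σ (j ∷ ρ) φ)
      ∼⟨ congˡ (λ {i} → SK-sym (⋁-⊨ α (i ∷ b) _)) ⟩
    ⟦ α ⟧ b ⊨ translate σ ρ (∃' φ) ∎
  inflate-⊨-⇔ (∀' φ) {e} {b} {ρ} e≗b⊗ρ = begin
    ((a : Fin (n * s)) → ⟦ inflate α σ ⟧ (a ∷ e) ⊨ φ)
      ∼⟨ Π-combine-⇔ ⟩
    ((i : Fin n) (j : Fin s) → ⟦ inflate α σ ⟧ (combine i j ∷ e) ⊨ φ)
      ∼⟨ Π-cong-⇔ (λ i → Π-cong-⇔ λ j → inflate-⊨-⇔ φ (∷-⊗ i j e≗b⊗ρ)) ⟩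
    ((i : Fin n) (j : Fin s) → ⟦ α ⟧ (i ∷ b) ⊨ translate σ (j ∷ ρ) φ)
      ∼⟨ Π-cong-⇔ (λ i → SK-sym (⋀-⊨ α (i ∷ b) _)) ⟩
    ⟦ α ⟧ b ⊨ translate σ ρ (∀' φ) ∎

proposition4p6 : (n m k : ℕ) (α : Permutation′ n) (β : Permutation′ m) →
    1 ≤ k → α ∼[ k ] β →
    {s : ℕ} (σ : Permutation′ s) → inflate α σ ∼[ k ] inflate β σ
proposition4p6 n m k α β _ α∼β σ φ φ≤k = begin
  inflate α σ ⊨ φ             ∼⟨ inflate-⊨-⇔ α σ φ (λ ()) ⟩
  α ⊨ translate σ (λ ()) φ     ∼⟨ α∼β (translate σ (λ ()) φ) (≤-trans (translate-qdepth σ (λ ()) φ) φ≤k) ⟩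
  β ⊨ translate σ (λ ()) φ     ∼⟨ SK-sym (inflate-⊨-⇔ β σ φ (λ ())) ⟩
  inflate β σ ⊨ φ             ∎
  where open EquationalReasoning
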